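{- Let $q\geq 4$ be a fixed integer and let $G$ be a graph with a separable $p$-component $H$, with separation $H\to(H_1,H_2)$, such that $H$ has fewer than $q$ vertices, $G-H$ is nonempty, and every vertex of $G-H$ is adjacent to all vertices of $H_1$ and non-adjacent to all vertices of $H_2$. Then $G$ is well covered if and only if $G-H$ and $H_2$ are well covered and every maximal independent set of $H$ containing a vertex of $H_1$ has exactly $\alpha(G-H)+\alpha(H_2)$ vertices.
   Context: $\alpha(X)$ is the size of a maximum independent set of the graph $X$; a graph is well covered if all its maximal independent sets have the same size. A graph is $p$-connected if for every bipartition of its vertex set there is a crossing $P_4$, i.e. an induced path on four vertices with vertices in both parts. A $p$-component of $G$ is a maximal $p$-connected induced subgraph. A graph $H$ is separable if its vertex set can be partitioned into two parts $H_1,H_2$ such that every induced $P_4$ $wxyz$ with vertices in both parts satisfies $x,y\in V(H_1)$ and $w,z\in V(H_2)$; this is written $H\to(H_1,H_2)$, and $H_1,H_2$ also denote the induced subgraphs. -}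

module Defs where

open import Data.Nat using (ℕ; _≤_)
open import Data.Fin using (Fin)
open import Data.Fin.Subset using (Subset; _∈_; _∉_; _⊆_; _⊂_; ∣_∣; Nonempty)
open import Data.Product using (Σ; _×_; ∃; ∃-syntax)
open import Data.Sum using (_⊎_)
open import Relation.Nullary using (¬_)
open import Relation.Binary.PropositionalEquality using (_≡_)
open import Function.Bundles using (_⇔_)

record Graph (n : ℕ) : Set₁ where
  field
    Adj   : Fin n → Fin n → Set
    sym   : ∀ {u v} → Adj u v → Adj v u
    irrefl : ∀ {v} → ¬ Adj v v
open Graph public

module _ {n : ℕ} (G : Graph n) where

  -- All notions below refer to the induced subgraph G[S] of a vertex set S.

  Independent : Subset n → Subset n → Set
  Independent S I = I ⊆ S × (∀ {u v} → u ∈ I → v ∈ I → ¬ Adj G u v)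

  MaximalIndependent : Subset n → Subset n → Set
  MaximalIndependent S I =
    Independent S I × (∀ J → I ⊆ J → Independent S J → J ⊆ I)

  WellCovered : Subset n → Set
  WellCovered S = ∀ I J → MaximalIndependent S I → MaximalIndependent S J → ∣ I ∣ ≡ ∣ J ∣

  IsAlpha : Subset n → ℕ → Set
  IsAlpha S k = (∃[ I ] (Independent S I × ∣ I ∣ ≡ k)) × (∀ I → Independent S I → ∣ I ∣ ≤ k)

  -- w x y z is an induced P4 (path w - x - y - z) of G[S].
  -- (Distinctness of the four vertices follows from these conditions.)
  InducedP4 : Subset n → Fin n → Fin n → Fin n → Fin n → Set
  InducedP4 S w x y z =
    w ∈ S × x ∈ S × y ∈ S × z ∈ S ×
    Adj G w x × Adj G x y × Adj G y z ×
    ¬ Adj G w y × ¬ Adj G w z × ¬ Adj G x z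

  Meets : Subset n → Fin n → Fin n → Fin n → Fin n → Set
  Meets A w x y z = w ∈ A ⊎ x ∈ A ⊎ y ∈ A ⊎ z ∈ A

  PConnected : Subset n → Set
  PConnected S =
    ∀ (A B : Subset n) → (∀ v → (v ∈ S) ⇔ (v ∈ A ⊎ v ∈ B)) →
    (∀ v → v ∈ A → v ∉ B) → Nonempty A → Nonempty B →
    ∃[ w ] ∃[ x ] ∃[ y ] ∃[ z ] (InducedP4 S w x y z × Meets A w x y z × Meets B w x y z)

  PComponent : Subset n → Set
  PComponent H = Nonempty H × PConnected H × (∀ T → H ⊂ T → ¬ PConnected T)

  Separation : Subset n → Subset n → Subset n → Set
  Separation H H₁ H₂ =
    (∀ v → (v ∈ H) ⇔ (v ∈ H₁ ⊎ v ∈ H₂)) × (∀ v → v ∈ H₁ → v ∉ H₂) ×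
    Nonempty H₁ × Nonempty H₂ ×
    (∀ w x y z → InducedP4 H w x y z → Meets H₁ w x y z → Meets H₂ w x y z →
       (x ∈ H₁ × y ∈ H₁ × w ∈ H₂ × z ∈ H₂))

-- A maximal independent set I of G is of one of two kinds. If I meets H₁ it avoids
-- G − H, which is complete to H₁, and the sets of this kind are exactly the maximal
-- independent sets of H meeting H₁. If I avoids H₁ it is the union of a maximal
-- independent set of G − H and one of H₂, since G − H is anticomplete to H₂;
-- conversely every such union is maximal in G, because its part in the nonempty
-- G − H dominates H₁. Fixing one part of such a union and varying the other transfers
-- well-coveredness from G to G − H and to H₂.
--
-- Building maximal independent sets needs decidable adjacency. Adjacency on a finite
-- vertex set is decidable up to double negation, and every conclusion is an equality
-- of natural numbers, so this can be assumed for free.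
module Submission where

open import Defs
open import Data.Nat using (ℕ; _≤_; _<_; _+_)
open import Data.Fin using (Fin)
open import Data.Fin.Subset using (Subset; _∈_; _∉_; _∩_; ∁; ∣_∣; Nonempty; ⊤)
open import Data.Product using (_×_; ∃-syntax)
open import Relation.Nullary using (¬_)
open import Relation.Binary.PropositionalEquality using (_≡_)
open import Function.Bundles using (_⇔_)

open import Data.Nat using (zero; suc)
open import Data.Nat.Properties using (+-suc; +-cancelʳ-≡; +-cancelˡ-≡; ≤-antisym; _≟_)
import Data.Fin as Fin
open import Data.Fin.Properties using (all?; any?)
open import Data.Fin.Subset using (_∪_; _⊆_; _⊂_; _⊃_; ⁅_⁆; Empty; inside; outside) renaming (⊥ to ∅)
open import Data.Fin.Subset.Properties
open import Data.Fin.Subset.Induction using (Acc; acc; ⊃-wellFounded)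
open import Data.Vec using ([]; _∷_; here)
open import Data.Product using (_,_; proj₁; proj₂)
open import Data.Sum using (_⊎_; inj₁; inj₂)
open import Data.Empty using (⊥-elim)
open import Function using (id; _∘_)
open import Relation.Nullary using (yes; no; ¬?)
open import Relation.Nullary.Decidable using (Dec; _×-dec_; _→-dec_; decidable-stable; ¬¬-excluded-middle)
open import Relation.Binary.Definitions using (Decidable)
open import Relation.Binary.PropositionalEquality using (refl; cong; cong₂; subst; trans; module ≡-Reasoning)
  renaming (sym to ≡-sym)
open import Function.Bundles using (mk⇔; Equivalence)
open Equivalence using (to; from)

∣p∪q∣≡∣p∣+∣q∣ : ∀ {n} (p q : Subset n) → Empty (p ∩ q) → ∣ p ∪ q ∣ ≡ ∣ p ∣ + ∣ q ∣
∣p∪q∣≡∣p∣+∣q∣ []            []            _     = refl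
∣p∪q∣≡∣p∣+∣q∣ (inside  ∷ p) (inside  ∷ q) empty = ⊥-elim (empty (Fin.zero , here))
∣p∪q∣≡∣p∣+∣q∣ (inside  ∷ p) (outside ∷ q) empty = cong suc (∣p∪q∣≡∣p∣+∣q∣ p q (drop-∷-Empty empty))
∣p∪q∣≡∣p∣+∣q∣ (outside ∷ p) (inside  ∷ q) empty =
  trans (cong suc (∣p∪q∣≡∣p∣+∣q∣ p q (drop-∷-Empty empty))) (≡-sym (+-suc ∣ p ∣ ∣ q ∣))
∣p∪q∣≡∣p∣+∣q∣ (outside ∷ p) (outside ∷ q) empty = ∣p∪q∣≡∣p∣+∣q∣ p q (drop-∷-Empty empty)

∣p∣≡∣p∩q∣+∣p∩r∣ : ∀ {n} (p q r : Subset n) → p ⊆ q ∪ r → Empty (q ∩ r) →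
  ∣ p ∣ ≡ ∣ p ∩ q ∣ + ∣ p ∩ r ∣
∣p∣≡∣p∩q∣+∣p∩r∣ p q r p⊆q∪r empty =
  trans (cong ∣_∣ p≡p∩q∪p∩r) (∣p∪q∣≡∣p∣+∣q∣ (p ∩ q) (p ∩ r) disjoint)
  where
  split : p ⊆ (p ∩ q) ∪ (p ∩ r)
  split x∈p with x∈p∪q⁻ q r (p⊆q∪r x∈p)
  ... | inj₁ x∈q = x∈p∪q⁺ (inj₁ (x∈p∩q⁺ (x∈p , x∈q)))
  ... | inj₂ x∈r = x∈p∪q⁺ (inj₂ (x∈p∩q⁺ (x∈p , x∈r)))
  merge : (p ∩ q) ∪ (p ∩ r) ⊆ p
  merge x∈ with x∈p∪q⁻ (p ∩ q) (p ∩ r) x∈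
  ... | inj₁ x∈p∩q = p∩q⊆p p q x∈p∩q
  ... | inj₂ x∈p∩r = p∩q⊆p p r x∈p∩r
  p≡p∩q∪p∩r : p ≡ (p ∩ q) ∪ (p ∩ r)
  p≡p∩q∪p∩r = ⊆-antisym split merge
  disjoint : Empty ((p ∩ q) ∩ (p ∩ r))
  disjoint (x , x∈) with x∈p∩q⁻ (p ∩ q) (p ∩ r) x∈
  ... | x∈p∩q , x∈p∩r = empty (x , x∈p∩q⁺ (p∩q⊆q p q x∈p∩q , p∩q⊆q p r x∈p∩r))

¬¬-∀-Fin : ∀ {m} {P : Fin m → Set} → (∀ i → ¬ ¬ P i) → ¬ ¬ (∀ i → P i)
¬¬-∀-Fin {zero}  _    ¬∀ = ¬∀ (λ ())
¬¬-∀-Fin {suc m} ¬¬P ¬∀ =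
  ¬¬P Fin.zero λ P₀ → ¬¬-∀-Fin (¬¬P ∘ Fin.suc) λ P₊ →
    ¬∀ λ { Fin.zero → P₀ ; (Fin.suc i) → P₊ i }

module _ {n : ℕ} (G : Graph n) where

  adjacency-¬¬-decidable : ¬ ¬ Decidable (Adj G)
  adjacency-¬¬-decidable = ¬¬-∀-Fin (λ u → ¬¬-∀-Fin (λ v → ¬¬-excluded-middle))

  classically : ∀ {a b : ℕ} → (Decidable (Adj G) → a ≡ b) → a ≡ b
  classically {a} {b} f =
    decidable-stable (a ≟ b) (λ a≢b → adjacency-¬¬-decidable (λ adj? → a≢b (f adj?)))

  ∩-independent : ∀ {S T I} → Independent G T I → Independent G S (I ∩ S)
  ∩-independent {S} {I = I} (_ , indI) =
    p∩q⊆q I S , λ u∈ v∈ → indI (p∩q⊆p I S u∈) (p∩q⊆p I S v∈)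

  ∪-independent : ∀ {S I J} → Independent G S I → Independent G S J →
    (∀ {u v} → u ∈ I → v ∈ J → ¬ Adj G u v) → Independent G S (I ∪ J)
  ∪-independent {S} {I} {J} (I⊆S , indI) (J⊆S , indJ) cross = I∪J⊆S , indI∪J
    where
    I∪J⊆S : I ∪ J ⊆ S
    I∪J⊆S x∈ with x∈p∪q⁻ I J x∈
    ... | inj₁ x∈I = I⊆S x∈I
    ... | inj₂ x∈J = J⊆S x∈J
    indI∪J : ∀ {u v} → u ∈ I ∪ J → v ∈ I ∪ J → ¬ Adj G u v
    indI∪J u∈ v∈ with x∈p∪q⁻ I J u∈ | x∈p∪q⁻ I J v∈
    ... | inj₁ u∈I | inj₁ v∈I = indI u∈I v∈I
    ... | inj₁ u∈I | inj₂ v∈J = cross u∈I v∈J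
    ... | inj₂ u∈J | inj₁ v∈I = cross v∈I u∈J ∘ sym G
    ... | inj₂ u∈J | inj₂ v∈J = indJ u∈J v∈J

  ⁅⁆-independent : ∀ {S v} → v ∈ S → Independent G S ⁅ v ⁆
  ⁅⁆-independent {v = v} v∈S =
    (λ u∈ → subst (_∈ _) (≡-sym (x∈⁅y⁆⇒x≡y v u∈)) v∈S) ,
    λ u∈ w∈ → no-loop (x∈⁅y⁆⇒x≡y v u∈) (x∈⁅y⁆⇒x≡y v w∈)
    where
    no-loop : ∀ {u w} → u ≡ v → w ≡ v → ¬ Adj G u w
    no-loop refl refl = irrefl G

  maximal-absorbs : ∀ {S T I J} → MaximalIndependent G S I → I ⊆ J → Independent G T J →
    J ∩ S ⊆ I
  maximal-absorbs {S} {J = J} ((I⊆S , _) , maxI) I⊆J indJ =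
    maxI (J ∩ S) (λ x∈I → x∈p∩q⁺ (I⊆J x∈I , I⊆S x∈I)) (∩-independent indJ)

  maximal-nonempty : ∀ {S I} → Nonempty S → MaximalIndependent G S I → Nonempty I
  maximal-nonempty {I = I} (r , r∈S) (_ , maxI) with nonempty? I
  ... | yes I≠∅ = I≠∅
  ... | no I=∅ = ⊥-elim (I=∅ (r , maxI ⁅ r ⁆ (λ {x} x∈I → ⊥-elim (I=∅ (x , x∈I)))
                                          (⁅⁆-independent r∈S) (x∈⁅x⁆ r)))

  maximal-∩ : ∀ {S I} → MaximalIndependent G ⊤ I →
    (∀ {u w} → u ∈ S → w ∈ I → w ∉ S → ¬ Adj G u w) → MaximalIndependent G S (I ∩ S)
  maximal-∩ {S} {I} ((_ , indI) , maxI) closed = ∩-independent (⊆⊤ , indI) , absorbs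
    where
    absorbs : ∀ J → I ∩ S ⊆ J → Independent G S J → J ⊆ I ∩ S
    absorbs J I∩S⊆J (J⊆S , indJ) x∈J = x∈p∩q⁺ (maxI (I ∪ J) (p⊆p∪q J) I∪J-independent
      (x∈p∪q⁺ (inj₂ x∈J)) , J⊆S x∈J)
      where
      cross : ∀ {u v} → u ∈ I → v ∈ J → ¬ Adj G u v
      cross {u} u∈I v∈J with u ∈? S
      ... | yes u∈S = indJ (I∩S⊆J (x∈p∩q⁺ (u∈I , u∈S))) v∈J
      ... | no u∉S = closed (J⊆S v∈J) u∈I u∉S ∘ sym G
      I∪J-independent : Independent G ⊤ (I ∪ J)
      I∪J-independent = ∪-independent (⊆⊤ , indI) (⊆⊤ , indJ) cross

  module _ (adj? : Decidable (Adj G)) where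

    Addable : Subset n → Subset n → Fin n → Set
    Addable S I v = v ∈ S × v ∉ I × (∀ u → u ∈ I → ¬ Adj G u v)

    addable? : ∀ S I → (v : Fin n) → Dec (Addable S I v)
    addable? S I v = v ∈? S ×-dec ¬? (v ∈? I) ×-dec all? (λ u → u ∈? I →-dec ¬? (adj? u v))

    unaddable⇒maximal : ∀ {S I} → Independent G S I → ¬ (∃[ v ] Addable S I v) →
      MaximalIndependent G S I
    unaddable⇒maximal {I = I} indI none = indI , absorbs
      where
      absorbs : ∀ J → I ⊆ J → Independent G _ J → J ⊆ I
      absorbs J I⊆J (J⊆S , indJ) {v} v∈J with v ∈? I
      ... | yes v∈I = v∈I
      ... | no v∉I = ⊥-elim (none (v , J⊆S v∈J , v∉I , λ u u∈I → indJ (I⊆J u∈I) v∈J))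

    extend : ∀ {S I} → Acc _⊃_ I → Independent G S I →
      ∃[ J ] (I ⊆ J × MaximalIndependent G S J)
    extend {S} {I} (acc larger) indI with any? (addable? S I)
    ... | no none = I , id , unaddable⇒maximal indI none
    ... | yes (v , v∈S , v∉I , free) with extend (larger I⊂I∪v) indI∪v
      where
      I⊂I∪v : I ⊂ I ∪ ⁅ v ⁆
      I⊂I∪v = p⊆p∪q ⁅ v ⁆ , v , x∈p∪q⁺ (inj₂ (x∈⁅x⁆ v)) , v∉I
      indI∪v : Independent G S (I ∪ ⁅ v ⁆)
      indI∪v = ∪-independent indI (⁅⁆-independent v∈S)
        (λ u∈I w∈ → subst (λ w → ¬ Adj G _ w) (≡-sym (x∈⁅y⁆⇒x≡y v w∈)) (free _ u∈I))
    ... | J , I∪v⊆J , maxJ = J , I∪v⊆J ∘ p⊆p∪q ⁅ v ⁆ , maxJ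

    maximal-exists : ∀ S → ∃[ J ] MaximalIndependent G S J
    maximal-exists S with extend (⊃-wellFounded ∅) (⊥-elim ∘ ∉⊥ , λ u∈∅ → ⊥-elim (∉⊥ u∈∅))
    ... | J , _ , maxJ = J , maxJ

    isAlpha⇒maximal : ∀ {S a} → IsAlpha G S a →
      ∃[ J ] (MaximalIndependent G S J × ∣ J ∣ ≡ a)
    isAlpha⇒maximal {a = a} ((I , indI , ∣I∣≡a) , bound) with extend (⊃-wellFounded I) indI
    ... | J , I⊆J , maxJ =
      J , maxJ , ≤-antisym (bound J (proj₁ maxJ)) (subst (_≤ ∣ J ∣) ∣I∣≡a (p⊆q⇒∣p∣≤∣q∣ I⊆J))

    wellCovered⇒isAlpha : ∀ {S J} → WellCovered G S → MaximalIndependent G S J →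
      IsAlpha G S ∣ J ∣
    wellCovered⇒isAlpha {J = J} wc maxJ = (J , proj₁ maxJ , refl) , bound
      where
      bound : ∀ I → Independent G _ I → ∣ I ∣ ≤ ∣ J ∣
      bound I indI with extend (⊃-wellFounded I) indI
      ... | K , I⊆K , maxK = subst (∣ I ∣ ≤_) (wc K J maxK maxJ) (p⊆q⇒∣p∣≤∣q∣ I⊆K)

module Split {n : ℕ} (G : Graph n) (H H₁ H₂ : Subset n)
  (cover : ∀ v → (v ∈ H) ⇔ (v ∈ H₁ ⊎ v ∈ H₂)) (outside-nonempty : Nonempty (∁ H))
  (complete : ∀ v u → v ∉ H → u ∈ H₁ → Adj G v u)
  (anticomplete : ∀ v u → v ∉ H → u ∈ H₂ → ¬ Adj G v u) where

  H₂⊆H : H₂ ⊆ H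
  H₂⊆H {v} v∈H₂ = from (cover v) (inj₂ v∈H₂)

  apart : ∀ {A B} → A ⊆ ∁ H → B ⊆ H₂ → Empty (A ∩ B)
  apart {A} {B} A⊆∁H B⊆H₂ (v , v∈A∩B) with x∈p∩q⁻ A B v∈A∩B
  ... | v∈A , v∈B = x∈∁p⇒x∉p (A⊆∁H v∈A) (H₂⊆H (B⊆H₂ v∈B))

  meets-H₁⇒⊆H : ∀ {T J} → Independent G T J → Nonempty (J ∩ H₁) → J ⊆ H
  meets-H₁⇒⊆H {J = J} (_ , indJ) (w , w∈J∩H₁) {v} v∈J with v ∈? H
  ... | yes v∈H = v∈H
  ... | no v∉H = ⊥-elim (indJ v∈J (p∩q⊆p J H₁ w∈J∩H₁) (complete v w v∉H (p∩q⊆q J H₁ w∈J∩H₁)))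

  maximal-meeting-H₁ : ∀ {I} → Nonempty (I ∩ H₁) →
    MaximalIndependent G ⊤ I ⇔ MaximalIndependent G H I
  maximal-meeting-H₁ {I} (w , w∈I∩H₁) = mk⇔
    (λ { (indI , maxI) → (meets-H₁⇒⊆H indI (w , w∈I∩H₁) , proj₂ indI) ,
                         λ J I⊆J indJ → maxI J I⊆J (⊆⊤ , proj₂ indJ) })
    (λ { ((_ , indI) , maxI) → (⊆⊤ , indI) ,
                         λ J I⊆J indJ → maxI J I⊆J (meets-H₁⇒⊆H indJ (w , J∩H₁∋w I⊆J) , proj₂ indJ) })
    where
    J∩H₁∋w : ∀ {J} → I ⊆ J → w ∈ J ∩ H₁
    J∩H₁∋w I⊆J = x∈p∩q⁺ (I⊆J (p∩q⊆p I H₁ w∈I∩H₁) , p∩q⊆q I H₁ w∈I∩H₁)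

  avoids-H₁⇒⊆∁H∪H₂ : ∀ {I} → Empty (I ∩ H₁) → I ⊆ ∁ H ∪ H₂
  avoids-H₁⇒⊆∁H∪H₂ {I} I∩H₁=∅ {v} v∈I with v ∈? H
  ... | no v∉H = x∈p∪q⁺ (inj₁ (x∉p⇒x∈∁p v∉H))
  ... | yes v∈H with to (cover v) v∈H
  ...   | inj₁ v∈H₁ = ⊥-elim (I∩H₁=∅ (v , x∈p∩q⁺ (v∈I , v∈H₁)))
  ...   | inj₂ v∈H₂ = x∈p∪q⁺ (inj₂ v∈H₂)

  maximal-avoiding-H₁ : ∀ {I} → MaximalIndependent G ⊤ I → Empty (I ∩ H₁) →
    MaximalIndependent G (∁ H) (I ∩ ∁ H) × MaximalIndependent G H₂ (I ∩ H₂) ×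
    ∣ I ∣ ≡ ∣ I ∩ ∁ H ∣ + ∣ I ∩ H₂ ∣
  maximal-avoiding-H₁ {I} maxI I∩H₁=∅ =
    maximal-∩ G maxI ∁H-closed , maximal-∩ G maxI H₂-closed ,
    ∣p∣≡∣p∩q∣+∣p∩r∣ I (∁ H) H₂ (avoids-H₁⇒⊆∁H∪H₂ I∩H₁=∅) (apart id id)
    where
    other-side : ∀ {S T w} → I ⊆ S ∪ T → w ∈ I → w ∉ S → w ∈ T
    other-side {S} {T} I⊆S∪T w∈I w∉S with x∈p∪q⁻ S T (I⊆S∪T w∈I)
    ... | inj₁ w∈S = ⊥-elim (w∉S w∈S)
    ... | inj₂ w∈T = w∈T
    ∁H-closed : ∀ {u w} → u ∈ ∁ H → w ∈ I → w ∉ ∁ H → ¬ Adj G u w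
    ∁H-closed {u} {w} u∈∁H w∈I w∉∁H =
      anticomplete u w (x∈∁p⇒x∉p u∈∁H) (other-side (avoids-H₁⇒⊆∁H∪H₂ I∩H₁=∅) w∈I w∉∁H)
    H₂-closed : ∀ {u w} → u ∈ H₂ → w ∈ I → w ∉ H₂ → ¬ Adj G u w
    H₂-closed {u} {w} u∈H₂ w∈I w∉H₂ =
      anticomplete w u (x∈∁p⇒x∉p w∈∁H) u∈H₂ ∘ sym G
      where
      w∈∁H : w ∈ ∁ H
      w∈∁H = other-side (subst (I ⊆_) (∪-comm (∁ H) H₂) (avoids-H₁⇒⊆∁H∪H₂ I∩H₁=∅)) w∈I w∉H₂

  -- No vertex of H₁ can be added to A ∪ B: A is nonempty and complete to H₁.
  maximal-∪ : ∀ {A B} → MaximalIndependent G (∁ H) A → MaximalIndependent G H₂ B →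
    MaximalIndependent G ⊤ (A ∪ B)
  maximal-∪ {A} {B} maxA@((A⊆∁H , _) , _) maxB@((B⊆H₂ , _) , _) =
    ∪-independent G (⊆⊤ , proj₂ (proj₁ maxA)) (⊆⊤ , proj₂ (proj₁ maxB)) cross , absorbs
    where
    cross : ∀ {u v} → u ∈ A → v ∈ B → ¬ Adj G u v
    cross u∈A v∈B = anticomplete _ _ (x∈∁p⇒x∉p (A⊆∁H u∈A)) (B⊆H₂ v∈B)
    absorbs : ∀ J → A ∪ B ⊆ J → Independent G ⊤ J → J ⊆ A ∪ B
    absorbs J A∪B⊆J indJ {v} v∈J with v ∈? H
    ... | no v∉H = x∈p∪q⁺ (inj₁ (maximal-absorbs G maxA (A∪B⊆J ∘ p⊆p∪q B) indJ
                                   (x∈p∩q⁺ (v∈J , x∉p⇒x∈∁p v∉H))))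
    ... | yes v∈H with to (cover v) v∈H
    ...   | inj₂ v∈H₂ = x∈p∪q⁺ (inj₂ (maximal-absorbs G maxB (A∪B⊆J ∘ q⊆p∪q A B) indJ
                                        (x∈p∩q⁺ (v∈J , v∈H₂))))
    ...   | inj₁ v∈H₁ with maximal-nonempty G outside-nonempty maxA
    ...     | u , u∈A = ⊥-elim (proj₂ indJ (A∪B⊆J (p⊆p∪q B u∈A)) v∈J
                                  (complete u v (x∈∁p⇒x∉p (A⊆∁H u∈A)) v∈H₁))

  ∣maximal-∪∣ : ∀ {A B} → MaximalIndependent G (∁ H) A → MaximalIndependent G H₂ B →
    ∣ A ∪ B ∣ ≡ ∣ A ∣ + ∣ B ∣
  ∣maximal-∪∣ {A} {B} ((A⊆∁H , _) , _) ((B⊆H₂ , _) , _) = ∣p∪q∣≡∣p∣+∣q∣ A B (apart A⊆∁H B⊆H₂)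

  module _ (adj? : Decidable (Adj G)) where

    wellCovered⇒wellCovered-∁H : WellCovered G ⊤ → WellCovered G (∁ H)
    wellCovered⇒wellCovered-∁H wc A A′ maxA maxA′ with maximal-exists G adj? H₂
    ... | B , maxB = +-cancelʳ-≡ (∣ B ∣) (∣ A ∣) (∣ A′ ∣) (begin
      ∣ A ∣ + ∣ B ∣    ≡⟨ ≡-sym (∣maximal-∪∣ maxA maxB) ⟩
      ∣ A ∪ B ∣        ≡⟨ wc _ _ (maximal-∪ maxA maxB) (maximal-∪ maxA′ maxB) ⟩
      ∣ A′ ∪ B ∣       ≡⟨ ∣maximal-∪∣ maxA′ maxB ⟩
      ∣ A′ ∣ + ∣ B ∣   ∎)
      where open ≡-Reasoning

    wellCovered⇒wellCovered-H₂ : WellCovered G ⊤ → WellCovered G H₂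
    wellCovered⇒wellCovered-H₂ wc B B′ maxB maxB′ with maximal-exists G adj? (∁ H)
    ... | A , maxA = +-cancelˡ-≡ (∣ A ∣) (∣ B ∣) (∣ B′ ∣) (begin
      ∣ A ∣ + ∣ B ∣    ≡⟨ ≡-sym (∣maximal-∪∣ maxA maxB) ⟩
      ∣ A ∪ B ∣        ≡⟨ wc _ _ (maximal-∪ maxA maxB) (maximal-∪ maxA maxB′) ⟩
      ∣ A ∪ B′ ∣       ≡⟨ ∣maximal-∪∣ maxA maxB′ ⟩
      ∣ A ∣ + ∣ B′ ∣   ∎)
      where open ≡-Reasoning

    wellCovered⇒sizes : WellCovered G ⊤ → ∀ a b → IsAlpha G (∁ H) a → IsAlpha G H₂ b →
      ∀ I → MaximalIndependent G H I → Nonempty (I ∩ H₁) → ∣ I ∣ ≡ a + b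
    wellCovered⇒sizes wc a b αa αb I maxI meets
      with isAlpha⇒maximal G adj? αa | isAlpha⇒maximal G adj? αb
    ... | A , maxA , ∣A∣≡a | B , maxB , ∣B∣≡b = begin
      ∣ I ∣          ≡⟨ wc I (A ∪ B) (from (maximal-meeting-H₁ meets) maxI) (maximal-∪ maxA maxB) ⟩
      ∣ A ∪ B ∣      ≡⟨ ∣maximal-∪∣ maxA maxB ⟩
      ∣ A ∣ + ∣ B ∣  ≡⟨ cong₂ _+_ ∣A∣≡a ∣B∣≡b ⟩
      a + b          ∎
      where open ≡-Reasoning

    sizes⇒wellCovered : WellCovered G (∁ H) → WellCovered G H₂ →
      (∀ a b → IsAlpha G (∁ H) a → IsAlpha G H₂ b →
        ∀ I → MaximalIndependent G H I → Nonempty (I ∩ H₁) → ∣ I ∣ ≡ a + b) →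
      WellCovered G ⊤
    sizes⇒wellCovered wc-∁H wc-H₂ sizes I J maxI maxJ
      with maximal-exists G adj? (∁ H) | maximal-exists G adj? H₂
    ... | A , maxA | B , maxB = trans (size maxI) (≡-sym (size maxJ))
      where
      size : ∀ {X} → MaximalIndependent G ⊤ X → ∣ X ∣ ≡ ∣ A ∣ + ∣ B ∣
      size {X} maxX with nonempty? (X ∩ H₁)
      ... | yes meets = sizes ∣ A ∣ ∣ B ∣ (wellCovered⇒isAlpha G adj? wc-∁H maxA)
              (wellCovered⇒isAlpha G adj? wc-H₂ maxB) X (to (maximal-meeting-H₁ meets) maxX) meets
      ... | no avoids with maximal-avoiding-H₁ maxX avoids
      ...   | maxX∩∁H , maxX∩H₂ , split =
              trans split (cong₂ _+_ (wc-∁H _ A maxX∩∁H maxA) (wc-H₂ _ B maxX∩H₂ maxB))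

lemma19 : (q : ℕ) → 4 ≤ q → {n : ℕ} (G : Graph n) (H H₁ H₂ : Subset n) →
    PComponent G H → Separation G H H₁ H₂ → ∣ H ∣ < q → Nonempty (∁ H) →
    (∀ v u → v ∉ H → u ∈ H₁ → Adj G v u) →
    (∀ v u → v ∉ H → u ∈ H₂ → ¬ Adj G v u) →
    (WellCovered G ⊤ ⇔
    (WellCovered G (∁ H) × WellCovered G H₂ ×
    (∀ a b → IsAlpha G (∁ H) a → IsAlpha G H₂ b →
    ∀ I → MaximalIndependent G H I → Nonempty (I ∩ H₁) → ∣ I ∣ ≡ a + b)))
lemma19 _ _ G H H₁ H₂ _ (cover , _) _ outside-nonempty complete anticomplete = mk⇔
  (λ wc →
    (λ A A′ maxA maxA′ → classically G λ adj? →
      wellCovered⇒wellCovered-∁H adj? wc A A′ maxA maxA′) ,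
    (λ B B′ maxB maxB′ → classically G λ adj? →
      wellCovered⇒wellCovered-H₂ adj? wc B B′ maxB maxB′) ,
    (λ a b αa αb I maxI meets → classically G λ adj? →
      wellCovered⇒sizes adj? wc a b αa αb I maxI meets))
  (λ { (wc-∁H , wc-H₂ , sizes) I J maxI maxJ → classically G λ adj? →
      sizes⇒wellCovered adj? wc-∁H wc-H₂ sizes I J maxI maxJ })
  where open Split G H H₁ H₂ cover outside-nonempty complete anticomplete
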